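{- Let $(X,A,m,\alpha,r)$ be a reversible micro-macro system with $r$ equivariant, and let $a,b\in A$. The transitions $a\to b$ and $\bar r b\to\bar r a$ are both reproducible if and only if $\alpha(a)=b$. Under this condition, if $r$ is invariant, then $a\to b$ and $b\to a$ are both reproducible (so they form a cycle of reproducible transitions).
   Context: A micro-macro system $(X,A,m,\alpha)$ consists of finite sets $X$, $A$, a bijection $\alpha:X\to X$ and a surjection $m:X\to A$; a macrostate $a$ is identified with $m^{ -1}(a)\subseteq X$. It is reversible with reversion map $r:X\to X$ if $r^2=\mathrm{id}_X$ and $\alpha^{ -1}=r\alpha r$. $r$ is equivariant if there is a bijection $\bar r:A\to A$ with $mr=\bar r m$, and invariant if $mr=m$. A transition $a\to b$ is reproducible if $\alpha(a)\subseteq b$. -}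

module Defs where

open import Data.Nat using (ℕ)
open import Data.Fin using (Fin)
open import Data.Product using (Σ; ∃; _×_; _,_)
open import Function.Bundles using (_↔_; Inverse)
open import Function.Definitions using (Bijective)
open import Relation.Binary.PropositionalEquality using (_≡_)

record MMSystem (n k : ℕ) : Set where
  field
    α      : Fin n ↔ Fin n
    m      : Fin n → Fin k
    m-surj : ∀ (a : Fin k) → ∃ λ (x : Fin n) → m x ≡ a

  αf : Fin n → Fin n
  αf = Inverse.to α

  α⁻¹ : Fin n → Fin n
  α⁻¹ = Inverse.from α

open MMSystem public

-- x belongs to the macrostate a (identified with m⁻¹(a) ⊆ X)
_∈ₘ_ : ∀ {n k} {S : MMSystem n k} → Fin n → Fin k → Set
_∈ₘ_ {S = S} x a = m S x ≡ a

record IsReversion {n k} (S : MMSystem n k) (r : Fin n → Fin n) : Set where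
  field
    involutive : ∀ x → r (r x) ≡ x
    reverses   : ∀ x → α⁻¹ S x ≡ r (αf S (r x))

record EquivariantVia {n k} (S : MMSystem n k) (r : Fin n → Fin n)
                      (r̄ : Fin k → Fin k) : Set where
  field
    r̄-bij : Bijective _≡_ _≡_ r̄
    comm  : ∀ x → m S (r x) ≡ r̄ (m S x)

Invariant : ∀ {n k} (S : MMSystem n k) (r : Fin n → Fin n) → Set
Invariant S r = ∀ x → m S (r x) ≡ m S x

Reproducible : ∀ {n k} (S : MMSystem n k) (a b : Fin k) → Set
Reproducible S a b = ∀ x → m S x ≡ a → m S (αf S x) ≡ b

-- α(a) = b as subsets of X: α(m⁻¹ a) = m⁻¹ b
ImageEq : ∀ {n k} (S : MMSystem n k) (a b : Fin k) → Set
ImageEq S a b =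
  (∀ x → m S x ≡ a → m S (αf S x) ≡ b) ×
  (∀ y → m S y ≡ b → ∃ λ x → m S x ≡ a × αf S x ≡ y)

-- For any bijection α, α(a) = b means α(a) ⊆ b together with α⁻¹(b) ⊆ a. Since
-- α⁻¹ = r α r and m r = r̄ m, the reversion r carries the inclusion α(r̄ b) ⊆ r̄ a onto
-- α⁻¹(b) ⊆ a, which gives the equivalence. If moreover r is invariant then r̄ = id,
-- so the reversed transition r̄ b → r̄ a is just b → a.
module Submission where

open import Defs
open import Data.Fin using (Fin)
open import Data.Product using (_×_; _,_; proj₁; proj₂)
open import Function.Bundles using (_⇔_; mk⇔; Inverse; Equivalence)
open Equivalence using (to; from)
open import Relation.Binary.PropositionalEquality
open ≡-Reasoning

BackwardReproducible : ∀ {n k} (S : MMSystem n k) (a b : Fin k) → Set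
BackwardReproducible S a b = ∀ y → m S y ≡ b → m S (α⁻¹ S y) ≡ a

module _ {n k} (S : MMSystem n k) where

  imageEq⇔reproducible×backward : ∀ a b →
    ImageEq S a b ⇔ (Reproducible S a b × BackwardReproducible S a b)
  imageEq⇔reproducible×backward a b = mk⇔ split join
    where
    split : ImageEq S a b → Reproducible S a b × BackwardReproducible S a b
    split (forward , onto) = forward , backward
      where
      backward : BackwardReproducible S a b
      backward y y∈b with onto y y∈b
      ... | x , x∈a , refl = trans (cong (m S) (Inverse.strictlyInverseʳ (α S) x)) x∈a

    join : Reproducible S a b × BackwardReproducible S a b → ImageEq S a b
    join (forward , backward) =
      forward , λ y y∈b → α⁻¹ S y , backward y y∈b , Inverse.strictlyInverseˡ (α S) y

  module _ {r : Fin n → Fin n} {r̄ : Fin k → Fin k} (eqv : EquivariantVia S r r̄) where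
    open EquivariantVia eqv

    r̄-involutive : (∀ x → r (r x) ≡ x) → ∀ a → r̄ (r̄ a) ≡ a
    r̄-involutive involutive a with m-surj S a
    ... | x , refl = begin
      r̄ (r̄ (m S x))  ≡⟨ cong r̄ (comm x) ⟨
      r̄ (m S (r x))  ≡⟨ comm (r x) ⟨
      m S (r (r x))  ≡⟨ cong (m S) (involutive x) ⟩
      m S x          ∎

    r̄-identity : Invariant S r → ∀ a → r̄ a ≡ a
    r̄-identity invariant a with m-surj S a
    ... | x , refl = trans (sym (comm x)) (invariant x)

    module _ (rev : IsReversion S r) where
      open IsReversion rev

      α-conjugate : ∀ x → αf S x ≡ r (α⁻¹ S (r x))
      α-conjugate x = begin
        αf S x                 ≡⟨ involutive (αf S x) ⟨
        r (r (αf S x))         ≡⟨ cong (λ z → r (r (αf S z))) (involutive x) ⟨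
        r (r (αf S (r (r x)))) ≡⟨ cong r (reverses (r x)) ⟨
        r (α⁻¹ S (r x))        ∎

      reversed⇔backward : ∀ a b →
        Reproducible S (r̄ b) (r̄ a) ⇔ BackwardReproducible S a b
      reversed⇔backward a b = mk⇔ reverse unreverse
        where
        reverse : Reproducible S (r̄ b) (r̄ a) → BackwardReproducible S a b
        reverse reversed y y∈b = begin
          m S (α⁻¹ S y)            ≡⟨ cong (m S) (reverses y) ⟩
          m S (r (αf S (r y)))     ≡⟨ comm (αf S (r y)) ⟩
          r̄ (m S (αf S (r y)))     ≡⟨ cong r̄ (reversed (r y) (trans (comm y) (cong r̄ y∈b))) ⟩
          r̄ (r̄ a)                  ≡⟨ r̄-involutive involutive a ⟩
          a                        ∎

        unreverse : BackwardReproducible S a b → Reproducible S (r̄ b) (r̄ a)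
        unreverse backward x x∈r̄b = begin
          m S (αf S x)             ≡⟨ cong (m S) (α-conjugate x) ⟩
          m S (r (α⁻¹ S (r x)))    ≡⟨ comm (α⁻¹ S (r x)) ⟩
          r̄ (m S (α⁻¹ S (r x)))    ≡⟨ cong r̄ (backward (r x) r∈b) ⟩
          r̄ a                      ∎
          where
          r∈b : m S (r x) ≡ b
          r∈b = trans (comm x) (trans (cong r̄ x∈r̄b) (r̄-involutive involutive b))

proposition13 : ∀ {n k} (S : MMSystem n k) (r : Fin n → Fin n) (r̄ : Fin k → Fin k)
    → IsReversion S r → EquivariantVia S r r̄ → (a b : Fin k)
    → ((Reproducible S a b × Reproducible S (r̄ b) (r̄ a)) ⇔ ImageEq S a b)
    × (ImageEq S a b → Invariant S r → Reproducible S a b × Reproducible S b a)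
proposition13 S r r̄ rev eqv a b = characterisation , cycle
  where
  image⇔ : ImageEq S a b ⇔ (Reproducible S a b × BackwardReproducible S a b)
  image⇔ = imageEq⇔reproducible×backward S a b
  reversed⇔ : Reproducible S (r̄ b) (r̄ a) ⇔ BackwardReproducible S a b
  reversed⇔ = reversed⇔backward S eqv rev a b

  characterisation : (Reproducible S a b × Reproducible S (r̄ b) (r̄ a)) ⇔ ImageEq S a b
  characterisation = mk⇔
    (λ (forward , reversed) → from image⇔ (forward , to reversed⇔ reversed))
    (λ image → let forward , backward = to image⇔ image
               in forward , from reversed⇔ backward)

  cycle : ImageEq S a b → Invariant S r → Reproducible S a b × Reproducible S b a
  cycle image invariant = proj₁ image , subst₂ (Reproducible S) (r̄c≡c b) (r̄c≡c a) reversed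
    where
    r̄c≡c : ∀ c → r̄ c ≡ c
    r̄c≡c = r̄-identity S eqv invariant
    reversed : Reproducible S (r̄ b) (r̄ a)
    reversed = from reversed⇔ (proj₂ (to image⇔ image))
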